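{- For each integer $t \ge 2$ and each prime $p \ge 7$, the set $M_t = \{1, 2t-4, 2t-1, 2t+1, 2t+4, 4t-1\}$ contains an element whose remainder modulo $p$ differs from the remainders modulo $p$ of all other elements of $M_t$. -}

module Defs where

open import Data.Nat using (ℕ; _+_; _*_; _∸_)
open import Data.Vec using (Vec; _∷_; [])

-- For t ≥ 2 all entries are nonnegative, so truncated subtraction ∸ is exact,
-- and the six entries are pairwise distinct (so indices = elements).
M : ℕ → Vec ℕ 6
M t = 1 ∷ (2 * t ∸ 4) ∷ (2 * t ∸ 1) ∷ (2 * t + 1) ∷ (2 * t + 4) ∷ (4 * t ∸ 1) ∷ []

-- The four middle elements 2t−4, 2t−1, 2t+1, 2t+4 form the cluster a, a+3, a+5, a+8,
-- whose pairwise differences 2, 3, 5, 8 are not divisible by a prime p ≥ 7; so their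
-- residues are pairwise distinct. The two outer elements 1 and 4t−1 can share a residue
-- with at most two of a+3, a+5, a+8, so one of these three is alone in its class.
module Submission where

open import Defs
open import Data.Nat using (ℕ; zero; suc; _≤_; _<_; _<?_; _≟_; _+_; _*_; _∸_; _^_; _%_; _/_; NonZero)
open import Data.Nat.Properties
  using (+-assoc; +-comm; +-cancelˡ-≡; <-≤-trans; <⇒≤; m+[n∸m]≡n; *-monoʳ-≤)
open import Data.Nat.DivMod using (m≡m%n+[m/n]*n)
open import Data.Nat.Divisibility using (_∣_; _∤_; >⇒∤; n∣m*n; ∣m+n∣m⇒∣n)
open import Data.Nat.Primality using (Prime; euclidsLemma)
open import Data.Fin using (Fin)
open import Data.Fin.Patterns using (0F; 1F; 2F; 3F; 4F; 5F)
open import Data.Vec using (Vec; _∷_; []; lookup)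
open import Data.Product using (∃; _×_; _,_; swap)
open import Data.Sum using (_⊎_; inj₁; inj₂)
import Data.Sum as Sum
open import Relation.Nullary using (yes; no; contradiction)
open import Relation.Nullary.Decidable using (True; toWitness)
open import Relation.Binary.Definitions using (DecidableEquality)
open import Relation.Binary.PropositionalEquality
  using (_≡_; _≢_; refl; sym; trans; cong; subst; ≢-sym; module ≡-Reasoning)

[k+m]%n≡m%n⇒n∣k : ∀ k m {n} .{{_ : NonZero n}} → (k + m) % n ≡ m % n → n ∣ k
[k+m]%n≡m%n⇒n∣k k m {n} eq =
  ∣m+n∣m⇒∣n (subst (n ∣_) (sym quotients) (n∣m*n ((k + m) / n))) (n∣m*n (m / n))
  where
  open ≡-Reasoning
  r = m % n
  quotients : m / n * n + k ≡ (k + m) / n * n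
  quotients = +-cancelˡ-≡ r _ _ (begin
    r + (m / n * n + k)           ≡⟨ +-assoc r _ k ⟨
    r + m / n * n + k             ≡⟨ cong (_+ k) (m≡m%n+[m/n]*n m n) ⟨
    m + k                         ≡⟨ +-comm m k ⟩
    k + m                         ≡⟨ m≡m%n+[m/n]*n (k + m) n ⟩
    (k + m) % n + (k + m) / n * n ≡⟨ cong (_+ (k + m) / n * n) eq ⟩
    r + (k + m) / n * n           ∎)

shift-%-≢ : ∀ k m {n} .{{_ : NonZero n}} → n ∤ k → (k + m) % n ≢ m % n
shift-%-≢ k m n∤k eq = n∤k ([k+m]%n≡m%n⇒n∣k k m eq)

prime∤2^ : ∀ {p} → Prime p → 2 < p → ∀ k → p ∤ 2 ^ k
prime∤2^ _ 2<p zero = >⇒∤ (<⇒≤ 2<p)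
prime∤2^ pr 2<p (suc k) p∣2^[1+k] with euclidsLemma 2 (2 ^ k) pr p∣2^[1+k]
... | inj₁ p∣2   = >⇒∤ 2<p p∣2
... | inj₂ p∣2^k = prime∤2^ pr 2<p k p∣2^k

Avoids : ∀ {a} {A : Set a} → A → A → A → Set a
Avoids x u w = x ≢ u × x ≢ w

module _ {a} {A : Set a} (_≟ᴬ_ : DecidableEquality A) where

  one-of-two-avoids : ∀ {y z v w} → y ≢ z → y ≢ v → z ≢ v → Avoids y v w ⊎ Avoids z v w
  one-of-two-avoids {y} {z} {v} {w} y≢z y≢v z≢v with y ≟ᴬ w
  ... | no y≢w    = inj₁ (y≢v , y≢w)
  ... | yes y≡w   = inj₂ (z≢v , λ z≡w → y≢z (trans y≡w (sym z≡w)))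

  one-of-three-avoids : ∀ {x y z u w} → x ≢ y → x ≢ z → y ≢ z →
                        Avoids x u w ⊎ Avoids y u w ⊎ Avoids z u w
  one-of-three-avoids {x} {y} {z} {u} {w} x≢y x≢z y≢z with x ≟ᴬ u | x ≟ᴬ w
  ... | yes refl | _        = inj₂ (one-of-two-avoids y≢z (≢-sym x≢y) (≢-sym x≢z))
  ... | no x≢u   | no x≢w   = inj₁ (x≢u , x≢w)
  ... | no _     | yes refl = inj₂ (Sum.map swap swap (one-of-two-avoids y≢z (≢-sym x≢y) (≢-sym x≢z)))

Isolated : ∀ {n a} {A : Set a} → (Fin n → A) → Fin n → Set a
Isolated f i = ∀ j → j ≢ i → f i ≢ f j

cluster : ℕ → ℕ → ℕ → Vec ℕ 6
cluster x a y = x ∷ a ∷ 3 + a ∷ 5 + a ∷ 8 + a ∷ y ∷ []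

data Inner : Fin 6 → Set where
  inner₂ : Inner 2F
  inner₃ : Inner 3F
  inner₄ : Inner 4F

module _ {p} .{{_ : NonZero p}} (7≤p : 7 ≤ p) (pr : Prime p) (x a y : ℕ) where

  residue : Fin 6 → ℕ
  residue i = lookup (cluster x a y) i % p

  p∤<7 : ∀ d .{{_ : NonZero d}} {d<7 : True (d <? 7)} → p ∤ d
  p∤<7 d {d<7} = >⇒∤ (<-≤-trans (toWitness d<7) 7≤p)

  p∤8 : p ∤ 8
  p∤8 = prime∤2^ pr (<-≤-trans (toWitness {a? = 2 <? 7} _) 7≤p) 3

  residue₃≢residue₂ : residue 3F ≢ residue 2F
  residue₃≢residue₂ = shift-%-≢ 2 (3 + a) (p∤<7 2)

  residue₄≢residue₂ : residue 4F ≢ residue 2F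
  residue₄≢residue₂ = shift-%-≢ 5 (3 + a) (p∤<7 5)

  residue₄≢residue₃ : residue 4F ≢ residue 3F
  residue₄≢residue₃ = shift-%-≢ 3 (5 + a) (p∤<7 3)

  isolated-inner : ∀ {k} → Inner k → Avoids (residue k) (residue 0F) (residue 5F) →
                   Isolated residue k
  isolated-inner _      (k≢x , _) 0F _    = k≢x
  isolated-inner _      (_ , k≢y) 5F _    = k≢y
  isolated-inner inner₂ _         2F 2≢2  = contradiction refl 2≢2
  isolated-inner inner₃ _         3F 3≢3  = contradiction refl 3≢3
  isolated-inner inner₄ _         4F 4≢4  = contradiction refl 4≢4
  isolated-inner inner₂ _         1F _    = shift-%-≢ 3 a (p∤<7 3)
  isolated-inner inner₃ _         1F _    = shift-%-≢ 5 a (p∤<7 5)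
  isolated-inner inner₄ _         1F _    = shift-%-≢ 8 a p∤8
  isolated-inner inner₂ _         3F _    = ≢-sym residue₃≢residue₂
  isolated-inner inner₂ _         4F _    = ≢-sym residue₄≢residue₂
  isolated-inner inner₃ _         2F _    = residue₃≢residue₂
  isolated-inner inner₃ _         4F _    = ≢-sym residue₄≢residue₃
  isolated-inner inner₄ _         2F _    = residue₄≢residue₂
  isolated-inner inner₄ _         3F _    = residue₄≢residue₃

  cluster-has-isolated-residue : ∃ (Isolated residue)
  cluster-has-isolated-residue
    with one-of-three-avoids _≟_ {u = residue 0F} {w = residue 5F}
           (≢-sym residue₃≢residue₂) (≢-sym residue₄≢residue₂) (≢-sym residue₄≢residue₃)
  ... | inj₁ avoids₂        = 2F , isolated-inner inner₂ avoids₂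
  ... | inj₂ (inj₁ avoids₃) = 3F , isolated-inner inner₃ avoids₃
  ... | inj₂ (inj₂ avoids₄) = 4F , isolated-inner inner₄ avoids₄

M≡cluster : ∀ {t} → 2 ≤ t → M t ≡ cluster 1 (2 * t ∸ 4) (4 * t ∸ 1)
M≡cluster {t} 2≤t = shape (m+[n∸m]≡n (*-monoʳ-≤ 2 2≤t))
  where
  shape : ∀ {a n y} → 4 + a ≡ n →
          1 ∷ (n ∸ 4) ∷ (n ∸ 1) ∷ (n + 1) ∷ (n + 4) ∷ y ∷ [] ≡ cluster 1 a y
  shape {a} refl rewrite +-comm a 1 | +-comm a 4 = refl

lemma13 : ∀ (t p : ℕ) .{{_ : NonZero p}} → 2 ≤ t → 7 ≤ p → Prime p →
    ∃ λ (i : Fin 6) → ∀ (j : Fin 6) → j ≢ i →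
      lookup (M t) i % p ≢ lookup (M t) j % p
lemma13 t p 2≤t 7≤p pr rewrite M≡cluster 2≤t =
  cluster-has-isolated-residue 7≤p pr 1 (2 * t ∸ 4) (4 * t ∸ 1)
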